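{- Let $(f_0,f_1,f_2)$ be a coloring of $D_3(m)$ and let $(f'_0,f'_1,f'_2)$ be obtained from it by a Kempe swap of two colors $(r,s)$ on a set $X$ that is a union of cycles of $\tau_{r,s}=f_s^{ -1}\circ f_r$. Then \[\mathrm{sgn}(f'_0)\,\mathrm{sgn}(f'_1)\,\mathrm{sgn}(f'_2)=\mathrm{sgn}(f_0)\,\mathrm{sgn}(f_1)\,\mathrm{sgn}(f_2),\] where $\mathrm{sgn}$ denotes the sign of a permutation of $V$.
   Context: Let $m\ge 3$, $V=(\mathbb Z_m)^3$, and $e_1,e_2,e_3$ the standard basis vectors; $D_3(m)$ is the digraph on $V$ with arcs $v\to v+e_1,v+e_2,v+e_3$ (mod $m$). A coloring of $D_3(m)$ is a triple $(f_0,f_1,f_2)$ of permutations of $V$ such that $\{f_0(v),f_1(v),f_2(v)\}=\{v+e_1,v+e_2,v+e_3\}$ for every $v\in V$. For colors $r\ne s$ the Kempe map is $\tau_{r,s}=f_s^{ -1}\circ f_r$. For $X\subseteq V$, the Kempe swap of colors $(r,s)$ on $X$ produces $f'_r(v)=f_s(v)$, $f'_s(v)=f_r(v)$ for $v\in X$, $f'_r(v)=f_r(v)$, $f'_s(v)=f_s(v)$ for $v\notin X$, and $f'_t=f_t$ for the third color $t$. -}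

module Defs where

open import Data.Nat using (ℕ; zero; suc; _+_; _*_; _<ᵇ_)
open import Data.Nat.DivMod using (_mod_)
open import Data.Fin using (Fin; toℕ) renaming (zero to f0; suc to fs)
open import Data.Fin.Properties using (_≟_)
open import Data.Product using (_×_; _,_; ∃)
open import Data.Bool using (Bool; true; false; if_then_else_; _∧_)
open import Data.List using (List; map; concatMap; allFin)
open import Data.Nat.ListAction using (sum)
open import Data.Integer using (ℤ; -1ℤ) renaming (_^_ to _^ℤ_)
open import Function.Bundles using (_↔_; Inverse)
open import Relation.Nullary using (does)
open import Relation.Binary.PropositionalEquality using (_≡_)

-- ℤ_m represented by Fin m; successor modulo m
inc : ∀ {n} → Fin n → Fin n
inc {suc n} i = suc (toℕ i) mod (suc n)

V : ℕ → Set
V m = Fin m × Fin m × Fin m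

-- v + e_j  (j = 0,1,2 stands for e₁,e₂,e₃)
_+e_ : ∀ {m} → V m → Fin 3 → V m
(a , b , c) +e f0           = (inc a , b , c)
(a , b , c) +e fs f0        = (a , inc b , c)
(a , b , c) +e fs (fs f0)   = (a , b , inc c)

Perm : ℕ → Set
Perm m = V m ↔ V m

app : ∀ {m} → Perm m → V m → V m
app σ = Inverse.to σ

inv : ∀ {m} → Perm m → V m → V m
inv σ = Inverse.from σ

elems : (m : ℕ) → List (V m)
elems m = concatMap (λ a → concatMap (λ b → map (λ c → (a , b , c)) (allFin m)) (allFin m)) (allFin m)

rank : ∀ {m} → V m → ℕ
rank {m} (a , b , c) = (toℕ a * m + toℕ b) * m + toℕ c

inversions : ∀ {m} → Perm m → ℕ
inversions {m} σ =
  sum (concatMap (λ u → map (λ v →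
        if (rank u <ᵇ rank v) ∧ (rank (app σ v) <ᵇ rank (app σ u)) then 1 else 0)
      (elems m)) (elems m))

sgn : ∀ {m} → Perm m → ℤ
sgn σ = -1ℤ ^ℤ inversions σ

IsColoring : ∀ {m} → (Fin 3 → Perm m) → Set
IsColoring f = ∀ v →
  (∀ i → ∃ λ j → app (f i) v ≡ v +e j) × (∀ j → ∃ λ i → app (f i) v ≡ v +e j)

τ : ∀ {m} → (Fin 3 → Perm m) → Fin 3 → Fin 3 → V m → V m
τ f r s v = inv (f s) (app (f r) v)

-- X ⊆ V (as a Boolean predicate) is a union of cycles of τ: invariant under τ
UnionOfCycles : ∀ {m} → (V m → V m) → (V m → Bool) → Set
UnionOfCycles t X = ∀ v → X (t v) ≡ X v

swapValue : ∀ {m} → (Fin 3 → Perm m) → Fin 3 → Fin 3 → (V m → Bool) → Fin 3 → V m → V m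
swapValue f r s X c v =
  if X v
  then (if does (c ≟ r) then app (f s) v
        else if does (c ≟ s) then app (f r) v
        else app (f c) v)
  else app (f c) v

IsKempeSwap : ∀ {m} → (Fin 3 → Perm m) → Fin 3 → Fin 3 → (V m → Bool) → (Fin 3 → Perm m) → Set
IsKempeSwap f r s X f' = ∀ c v → app (f' c) v ≡ swapValue f r s X c v

{-# OPTIONS --safe #-}
-- Outside X the swap changes nothing, and on X it replaces f_s by f_s ∘ τ and f_r by
-- f_r ∘ τ⁻¹.  So f'_s = f_s ∘ ρ and f'_r = f_r ∘ ρ⁻¹, where ρ is τ on X and the identity
-- elsewhere (a permutation because X is τ-invariant), while the third color is unchanged.
-- Multiplicativity of the sign gives sgn f'_r · sgn f'_s = sgn f_r · sgn f_s · sgn ρ⁻¹ · sgn ρ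
-- = sgn f_r · sgn f_s.  Multiplicativity is proved by counting inversions:
-- inv (g ∘ π) + inv π and inv g differ by twice the number of pairs inverted by both π and g ∘ π.
module Submission where

open import Defs
open import Algebra.Properties.CommutativeSemigroup as CommutativeSemigroupProperties using ()
open import Data.Bool using (Bool; true; false; if_then_else_; _∧_; not)
open import Data.Bool.Properties using (∧-zeroʳ)
open import Data.Fin using (Fin; toℕ; combine) renaming (zero to f0; suc to fs)
open import Data.Fin.Properties using (_≟_; toℕ-injective; toℕ-combine; combine-injective)
open import Data.Integer using (ℤ; 1ℤ; -1ℤ; _*_) renaming (_^_ to _^ℤ_)
open import Data.Integer.Properties
  using (*-assoc; *-identityˡ; *-identityʳ; ^-distribˡ-+-*; *-commutativeSemigroup)
open import Data.List using (List; []; _∷_; map; concatMap; allFin; cartesianProduct; cartesianProductWith; _++_)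
open import Data.List.Membership.Propositional using (_∈_)
open import Data.List.Membership.Propositional.Properties
  using (∈-map⁺; ∈-allFin; ∈-cartesianProduct⁺)
open import Data.List.Membership.Propositional.Properties.WithK using (unique∧set⇒bag)
open import Data.List.Properties using (map-cong; map-∘; map-++; concatMap-cong)
open import Data.List.Relation.Binary.BagAndSetEquality using (∼bag⇒↭)
open import Data.List.Relation.Binary.Permutation.Propositional using (_↭_)
import Data.List.Relation.Binary.Permutation.Propositional.Properties as ↭
open import Data.List.Relation.Unary.Unique.Propositional using (Unique)
import Data.List.Relation.Unary.Unique.Propositional.Properties as Unique
open import Data.Nat as ℕ using (ℕ; zero; suc; _+_; _<ᵇ_; _≤_)
open import Data.Nat.ListAction using (sum)
open import Data.Nat.ListAction.Properties using (sum-↭)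
open import Data.Nat.Properties
  using (+-suc; +-commutativeSemigroup; *-comm; <ᵇ-reflects-<; <⇒≯; ≮⇒≥; ≤-antisym)
open import Data.Product using (_×_; _,_; ∃-syntax; uncurry)
open import Data.Product.Algebra using (×-comm)
open import Data.Product.Function.NonDependent.Propositional using (_×-↔_)
open import Function using (_∘_; id; _↔_; Inverse; Injection; mk↔ₛ′; mk⇔)
open import Function.Construct.Composition using (_↔-∘_)
open import Function.Properties.Inverse using (↔-sym; ↔⇒↣)
open import Relation.Binary.PropositionalEquality
open import Relation.Nullary using (contradiction; ofʸ; ofⁿ)
open import Relation.Nullary.Decidable using (dec-true; dec-false)

open Inverse using (to; from; strictlyInverseˡ; strictlyInverseʳ)
open ≡-Reasoning

private
  variable
    A B C : Set

  module ℕ+ = CommutativeSemigroupProperties +-commutativeSemigroup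
  module ℤ* = CommutativeSemigroupProperties *-commutativeSemigroup

↔-injective : (π : A ↔ B) → ∀ {x y} → to π x ≡ to π y → x ≡ y
↔-injective π = Injection.injective (↔⇒↣ π)

record IsUniqueEnumeration (xs : List A) : Set where
  field
    unique   : Unique xs
    complete : ∀ x → x ∈ xs

allFin-isUniqueEnumeration : ∀ n → IsUniqueEnumeration (allFin n)
allFin-isUniqueEnumeration n = record { unique = Unique.allFin⁺ n ; complete = ∈-allFin }

cartesianProduct-isUniqueEnumeration : {xs : List A} {ys : List B} →
  IsUniqueEnumeration xs → IsUniqueEnumeration ys → IsUniqueEnumeration (cartesianProduct xs ys)
cartesianProduct-isUniqueEnumeration xs-enum ys-enum = record
  { unique   = Unique.cartesianProduct⁺ (unique xs-enum) (unique ys-enum)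
  ; complete = λ (x , y) → ∈-cartesianProduct⁺ (complete xs-enum x) (complete ys-enum y)
  }
  where open IsUniqueEnumeration

∑ : List A → (A → ℕ) → ℕ
∑ xs F = sum (map F xs)

∑-cong : ∀ (xs : List A) {F G : A → ℕ} → (∀ x → F x ≡ G x) → ∑ xs F ≡ ∑ xs G
∑-cong xs F≡G = cong sum (map-cong F≡G xs)

∑-+ : ∀ (xs : List A) (F G : A → ℕ) → ∑ xs (λ x → F x + G x) ≡ ∑ xs F + ∑ xs G
∑-+ []       F G = refl
∑-+ (x ∷ xs) F G = begin
  (F x + G x) + ∑ xs (λ x → F x + G x) ≡⟨ cong ((F x + G x) +_) (∑-+ xs F G) ⟩
  (F x + G x) + (∑ xs F + ∑ xs G)      ≡⟨ ℕ+.interchange (F x) (G x) (∑ xs F) (∑ xs G) ⟩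
  (F x + ∑ xs F) + (G x + ∑ xs G)      ∎

map-↔-↭ : {xs : List A} → IsUniqueEnumeration xs → (π : A ↔ A) → map (to π) xs ↭ xs
map-↔-↭ {xs = xs} xs-enum π = ∼bag⇒↭ (unique∧set⇒bag
  (Unique.map⁺ (↔-injective π) unique) unique
  (λ {x} → mk⇔ (λ _ → complete x) (λ _ →
    subst (_∈ map (to π) xs) (strictlyInverseˡ π x) (∈-map⁺ (to π) (complete (from π x))))))
  where open IsUniqueEnumeration xs-enum

∑-reindex : {xs : List A} → IsUniqueEnumeration xs → (π : A ↔ A) (F : A → ℕ) →
            ∑ xs (F ∘ to π) ≡ ∑ xs F
∑-reindex {xs = xs} xs-enum π F = begin
  sum (map (F ∘ to π) xs)     ≡⟨ cong sum (map-∘ xs) ⟩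
  sum (map F (map (to π) xs)) ≡⟨ sum-↭ (↭.map⁺ F (map-↔-↭ xs-enum π)) ⟩
  sum (map F xs)              ∎

concatMap-map≡cartesianProductWith : ∀ (f : A → B → C) xs ys →
  concatMap (λ x → map (f x) ys) xs ≡ cartesianProductWith f xs ys
concatMap-map≡cartesianProductWith f []       ys = refl
concatMap-map≡cartesianProductWith f (x ∷ xs) ys =
  cong (map (f x) ys ++_) (concatMap-map≡cartesianProductWith f xs ys)

map-cartesianProductWith : ∀ {D : Set} (g : C → D) (f : A → B → C) xs ys →
  map g (cartesianProductWith f xs ys) ≡ cartesianProductWith (λ x y → g (f x y)) xs ys
map-cartesianProductWith g f []       ys = refl
map-cartesianProductWith g f (x ∷ xs) ys = begin
  map g (map (f x) ys ++ cartesianProductWith f xs ys)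
    ≡⟨ map-++ g (map (f x) ys) _ ⟩
  map g (map (f x) ys) ++ map g (cartesianProductWith f xs ys)
    ≡⟨ cong₂ _++_ (sym (map-∘ ys)) (map-cartesianProductWith g f xs ys) ⟩
  map (g ∘ f x) ys ++ cartesianProductWith (λ x y → g (f x y)) xs ys ∎

sum-concatMap-map : ∀ (F : A → B → ℕ) xs ys →
  sum (concatMap (λ x → map (F x) ys) xs) ≡ ∑ (cartesianProduct xs ys) (uncurry F)
sum-concatMap-map F xs ys = cong sum (begin
  concatMap (λ x → map (F x) ys) xs        ≡⟨ concatMap-map≡cartesianProductWith F xs ys ⟩
  cartesianProductWith F xs ys             ≡⟨ map-cartesianProductWith (uncurry F) _,_ xs ys ⟨
  map (uncurry F) (cartesianProduct xs ys) ∎)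

∑-zero : ∀ (xs : List A) → ∑ xs (λ _ → 0) ≡ 0
∑-zero []       = refl
∑-zero (x ∷ xs) = ∑-zero xs

𝟙 : Bool → ℕ
𝟙 b = if b then 1 else 0

-- With B = b', C = c' and their complements b, c within a: |C| + |B| = 2|B ∩ C| + |C ∖ B| + |B ∖ C|.
𝟙-+-𝟙-overlap : ∀ a b b' c c' → (a ≡ true → b ≡ not b') → (a ≡ true → c ≡ not c') →
  𝟙 (a ∧ c') + 𝟙 (a ∧ b') ≡ (𝟙 (a ∧ b' ∧ c') + 𝟙 (a ∧ b' ∧ c')) + (𝟙 (a ∧ b ∧ c') + 𝟙 (a ∧ b' ∧ c))
𝟙-+-𝟙-overlap false b b' c c' _ _ = refl
𝟙-+-𝟙-overlap true b b' c c' b≡¬b' c≡¬c' rewrite b≡¬b' refl | c≡¬c' refl = by-cases b' c'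
  where
  by-cases : ∀ b c → 𝟙 c + 𝟙 b ≡ (𝟙 (b ∧ c) + 𝟙 (b ∧ c)) + (𝟙 (not b ∧ c) + 𝟙 (b ∧ not c))
  by-cases false false = refl
  by-cases false true  = refl
  by-cases true  false = refl
  by-cases true  true  = refl

𝟙-split : ∀ a a' b c → (b ≡ true → a' ≡ not a) → 𝟙 (b ∧ c) ≡ 𝟙 (a ∧ b ∧ c) + 𝟙 (a' ∧ b ∧ c)
𝟙-split a a' false c _ rewrite ∧-zeroʳ a | ∧-zeroʳ a' = refl
𝟙-split a a' true  c a'≡¬a rewrite a'≡¬a refl = by-cases a c
  where
  by-cases : ∀ a c → 𝟙 c ≡ 𝟙 (a ∧ c) + 𝟙 (not a ∧ c)
  by-cases false c     = refl
  by-cases true  false = refl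
  by-cases true  true  = refl

-1^[n+n]≡1 : ∀ n → -1ℤ ^ℤ (n + n) ≡ 1ℤ
-1^[n+n]≡1 zero = refl
-1^[n+n]≡1 (suc n) rewrite +-suc n n | -1^[n+n]≡1 n = refl

-1^-even-cancel : ∀ m n o → ∃[ k ] m + n ≡ (k + k) + o → -1ℤ ^ℤ m * -1ℤ ^ℤ n ≡ -1ℤ ^ℤ o
-1^-even-cancel m n o (k , m+n≡2k+o) = begin
  -1ℤ ^ℤ m * -1ℤ ^ℤ n         ≡⟨ ^-distribˡ-+-* -1ℤ m n ⟨
  -1ℤ ^ℤ (m + n)              ≡⟨ cong (-1ℤ ^ℤ_) m+n≡2k+o ⟩
  -1ℤ ^ℤ ((k + k) + o)        ≡⟨ ^-distribˡ-+-* -1ℤ (k + k) o ⟩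
  -1ℤ ^ℤ (k + k) * -1ℤ ^ℤ o   ≡⟨ cong (_* -1ℤ ^ℤ o) (-1^[n+n]≡1 k) ⟩
  1ℤ * -1ℤ ^ℤ o               ≡⟨ *-identityˡ (-1ℤ ^ℤ o) ⟩
  -1ℤ ^ℤ o                    ∎

-- The parity argument only needs ≺ to be a tournament.
module Inversions {A : Set} {L : List A} (L-enum : IsUniqueEnumeration L)
                  (_≺_ : A → A → Bool)
                  (≺-irrefl : ∀ x → (x ≺ x) ≡ false)
                  (≺-flip : ∀ {x y} → x ≢ y → (y ≺ x) ≡ not (x ≺ y)) where

  inversionCount : (A → A) → ℕ
  inversionCount h = sum (concatMap (λ u → map (λ v → 𝟙 (u ≺ v ∧ h v ≺ h u)) L) L)

  sign : (A → A) → ℤ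
  sign h = -1ℤ ^ℤ inversionCount h

  private
    P : List (A × A)
    P = cartesianProduct L L

    P-enum : IsUniqueEnumeration P
    P-enum = cartesianProduct-isUniqueEnumeration L-enum L-enum

    inverted : (A → A) → A × A → ℕ
    inverted h (u , v) = 𝟙 (u ≺ v ∧ h v ≺ h u)

    inversionCount-as-∑ : ∀ h → inversionCount h ≡ ∑ P (inverted h)
    inversionCount-as-∑ h = sum-concatMap-map (λ u v → 𝟙 (u ≺ v ∧ h v ≺ h u)) L L

    ≺⇒≢ : ∀ {x y} → (x ≺ y) ≡ true → x ≢ y
    ≺⇒≢ {x} x≺y refl with () ← trans (sym x≺y) (≺-irrefl x)

    ≺-asym : ∀ x y → (x ≺ y ∧ y ≺ x) ≡ false
    ≺-asym x y with x ≺ y in x≺y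
    ... | false = refl
    ... | true  = trans (≺-flip (≺⇒≢ x≺y)) (cong not x≺y)

  inversionCount-cong : ∀ {h h'} → (∀ x → h x ≡ h' x) → inversionCount h ≡ inversionCount h'
  inversionCount-cong {h} {h'} h≗h' = begin
    inversionCount h    ≡⟨ inversionCount-as-∑ h ⟩
    ∑ P (inverted h)    ≡⟨ ∑-cong P (λ (u , v) → cong₂ (λ x y → 𝟙 (u ≺ v ∧ x ≺ y)) (h≗h' v) (h≗h' u)) ⟩
    ∑ P (inverted h')   ≡⟨ inversionCount-as-∑ h' ⟨
    inversionCount h'   ∎

  inversionCount-id : inversionCount id ≡ 0
  inversionCount-id = begin
    inversionCount id   ≡⟨ inversionCount-as-∑ id ⟩
    ∑ P (inverted id)   ≡⟨ ∑-cong P (λ (u , v) → cong 𝟙 (≺-asym u v)) ⟩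
    ∑ P (λ _ → 0)       ≡⟨ ∑-zero P ⟩
    0                   ∎

  module _ (g π : A ↔ A) where
    private
      gπ : A → A
      gπ = to g ∘ to π

      invertedByBoth invertedOnlyByGπ invertedOnlyByπ : A × A → ℕ
      invertedByBoth   (u , v) = 𝟙 (u ≺ v ∧ to π v ≺ to π u ∧ gπ v ≺ gπ u)
      invertedOnlyByGπ (u , v) = 𝟙 (u ≺ v ∧ to π u ≺ to π v ∧ gπ v ≺ gπ u)
      invertedOnlyByπ  (u , v) = 𝟙 (u ≺ v ∧ to π v ≺ to π u ∧ gπ u ≺ gπ v)

      both : ℕ
      both = ∑ P invertedByBoth

      inverted-gπ+inverted-π : ∀ q → inverted gπ q + inverted (to π) q
                       ≡ (invertedByBoth q + invertedByBoth q) + (invertedOnlyByGπ q + invertedOnlyByπ q)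
      inverted-gπ+inverted-π (u , v) = 𝟙-+-𝟙-overlap (u ≺ v) _ _ _ _
        (λ u≺v → ≺-flip λ πv≡πu → ≺⇒≢ u≺v (↔-injective π (sym πv≡πu)))
        (λ u≺v → ≺-flip λ gπv≡gπu → ≺⇒≢ u≺v (↔-injective π (↔-injective g (sym gπv≡gπu))))

      -- A pair x ≺ y inverted by g is (π u, π v) for a unique (u, v); it is counted by
      -- invertedOnlyByGπ (u, v) if u ≺ v, and by invertedOnlyByπ (v, u) otherwise.
      onlyByGπ+onlyByπ : ∑ P invertedOnlyByGπ + ∑ P invertedOnlyByπ ≡ inversionCount (to g)
      onlyByGπ+onlyByπ = begin
        ∑ P invertedOnlyByGπ + ∑ P invertedOnlyByπ
          ≡⟨ cong (∑ P invertedOnlyByGπ +_) (∑-reindex P-enum (×-comm A A) invertedOnlyByπ) ⟨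
        ∑ P invertedOnlyByGπ + ∑ P (invertedOnlyByπ ∘ to (×-comm A A))
          ≡⟨ ∑-+ P _ _ ⟨
        ∑ P (λ q → invertedOnlyByGπ q + invertedOnlyByπ (to (×-comm A A) q))
          ≡⟨ ∑-cong P (λ (u , v) → 𝟙-split (u ≺ v) (v ≺ u) _ _
               (λ πu≺πv → ≺-flip λ u≡v → ≺⇒≢ πu≺πv (cong (to π) u≡v))) ⟨
        ∑ P (inverted (to g) ∘ to (π ×-↔ π))
          ≡⟨ ∑-reindex P-enum (π ×-↔ π) (inverted (to g)) ⟩
        ∑ P (inverted (to g))
          ≡⟨ inversionCount-as-∑ (to g) ⟨
        inversionCount (to g) ∎

    inversionCount-∘ : ∃[ k ] inversionCount gπ + inversionCount (to π) ≡ (k + k) + inversionCount (to g)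
    inversionCount-∘ = both , (begin
      inversionCount gπ + inversionCount (to π)
        ≡⟨ cong₂ _+_ (inversionCount-as-∑ gπ) (inversionCount-as-∑ (to π)) ⟩
      ∑ P (inverted gπ) + ∑ P (inverted (to π))
        ≡⟨ ∑-+ P _ _ ⟨
      ∑ P (λ q → inverted gπ q + inverted (to π) q)
        ≡⟨ ∑-cong P inverted-gπ+inverted-π ⟩
      ∑ P (λ q → (invertedByBoth q + invertedByBoth q) + (invertedOnlyByGπ q + invertedOnlyByπ q))
        ≡⟨ ∑-+ P _ _ ⟩
      ∑ P (λ q → invertedByBoth q + invertedByBoth q) + ∑ P (λ q → invertedOnlyByGπ q + invertedOnlyByπ q)
        ≡⟨ cong₂ _+_ (∑-+ P _ _) (∑-+ P _ _) ⟩
      (both + both) + (∑ P invertedOnlyByGπ + ∑ P invertedOnlyByπ)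
        ≡⟨ cong ((both + both) +_) onlyByGπ+onlyByπ ⟩
      (both + both) + inversionCount (to g) ∎)

  sign-cong : ∀ {h h'} → (∀ x → h x ≡ h' x) → sign h ≡ sign h'
  sign-cong h≗h' = cong (-1ℤ ^ℤ_) (inversionCount-cong h≗h')

  sign*sign≡1 : ∀ h → sign h * sign h ≡ 1ℤ
  sign*sign≡1 h = begin
    sign h * sign h                          ≡⟨ ^-distribˡ-+-* -1ℤ (inversionCount h) (inversionCount h) ⟨
    -1ℤ ^ℤ (inversionCount h + inversionCount h) ≡⟨ -1^[n+n]≡1 (inversionCount h) ⟩
    1ℤ                                       ∎

  sign-∘ : ∀ (g π : A ↔ A) → sign (to g ∘ to π) ≡ sign (to g) * sign (to π)
  sign-∘ g π = begin
    sign gπ                              ≡⟨ *-identityʳ (sign gπ) ⟨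
    sign gπ * 1ℤ                         ≡⟨ cong (sign gπ *_) (sign*sign≡1 (to π)) ⟨
    sign gπ * (sign (to π) * sign (to π)) ≡⟨ *-assoc (sign gπ) _ _ ⟨
    sign gπ * sign (to π) * sign (to π)   ≡⟨ cong (_* sign (to π)) sign-gπ*sign-π ⟩
    sign (to g) * sign (to π)             ∎
    where
    gπ : A → A
    gπ = to g ∘ to π

    sign-gπ*sign-π : sign gπ * sign (to π) ≡ sign (to g)
    sign-gπ*sign-π = -1^-even-cancel (inversionCount gπ) (inversionCount (to π)) (inversionCount (to g))
                                     (inversionCount-∘ g π)

  sign-from*sign-to : ∀ (π : A ↔ A) → sign (from π) * sign (to π) ≡ 1ℤ
  sign-from*sign-to π = begin
    sign (from π) * sign (to π) ≡⟨ sign-∘ (↔-sym π) π ⟨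
    sign (from π ∘ to π)        ≡⟨ sign-cong (strictlyInverseʳ π) ⟩
    sign id                     ≡⟨ cong (-1ℤ ^ℤ_) inversionCount-id ⟩
    1ℤ                          ∎

<ᵇ-irrefl : ∀ n → (n <ᵇ n) ≡ false
<ᵇ-irrefl zero    = refl
<ᵇ-irrefl (suc n) = <ᵇ-irrefl n

<ᵇ-flip : ∀ {m n} → m ≢ n → (n <ᵇ m) ≡ not (m <ᵇ n)
<ᵇ-flip {m} {n} m≢n with m <ᵇ n | <ᵇ-reflects-< m n | n <ᵇ m | <ᵇ-reflects-< n m
... | true  | ofʸ m<n | true  | ofʸ n<m = contradiction n<m (<⇒≯ m<n)
... | true  | _       | false | _       = refl
... | false | _       | true  | _       = refl
... | false | ofⁿ m≮n | false | ofⁿ n≮m = contradiction (≤-antisym (≮⇒≥ n≮m) (≮⇒≥ m≮n)) m≢n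

rank≡toℕ-combine : ∀ {m} (a b c : Fin m) → rank (a , b , c) ≡ toℕ (combine (combine a b) c)
rank≡toℕ-combine {m} a b c = begin
  (toℕ a ℕ.* m + toℕ b) ℕ.* m + toℕ c  ≡⟨ cong (_+ toℕ c) (*-comm _ m) ⟩
  m ℕ.* (toℕ a ℕ.* m + toℕ b) + toℕ c  ≡⟨ cong (λ k → m ℕ.* (k + toℕ b) + toℕ c) (*-comm (toℕ a) m) ⟩
  m ℕ.* (m ℕ.* toℕ a + toℕ b) + toℕ c  ≡⟨ cong (λ k → m ℕ.* k + toℕ c) (toℕ-combine a b) ⟨
  m ℕ.* toℕ (combine a b) + toℕ c      ≡⟨ toℕ-combine (combine a b) c ⟨
  toℕ (combine (combine a b) c)        ∎

rank-injective : ∀ {m} {u v : V m} → rank u ≡ rank v → u ≡ v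
rank-injective {u = a , b , c} {v = a' , b' , c'} ranks≡
  with ab≡a'b' , refl ← combine-injective (combine a b) c (combine a' b') c'
         (toℕ-injective (trans (sym (rank≡toℕ-combine a b c)) (trans ranks≡ (rank≡toℕ-combine a' b' c'))))
  with refl , refl ← combine-injective a b a' b' ab≡a'b' = refl

elems≡cartesianProduct : ∀ m → elems m ≡ cartesianProduct (allFin m) (cartesianProduct (allFin m) (allFin m))
elems≡cartesianProduct m = begin
  concatMap (λ a → concatMap (λ b → map (λ c → (a , b , c)) Fm) Fm) Fm
    ≡⟨ concatMap-cong (λ a → trans (concatMap-map≡cartesianProductWith (λ b c → (a , b , c)) Fm Fm)
                                   (sym (map-cartesianProductWith (a ,_) _,_ Fm Fm))) Fm ⟩
  concatMap (λ a → map (a ,_) (cartesianProduct Fm Fm)) Fm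
    ≡⟨ concatMap-map≡cartesianProductWith _,_ Fm (cartesianProduct Fm Fm) ⟩
  cartesianProduct Fm (cartesianProduct Fm Fm) ∎
  where Fm = allFin m

elems-isUniqueEnumeration : ∀ m → IsUniqueEnumeration (elems m)
elems-isUniqueEnumeration m = subst IsUniqueEnumeration (sym (elems≡cartesianProduct m))
  (cartesianProduct-isUniqueEnumeration Fm-enum (cartesianProduct-isUniqueEnumeration Fm-enum Fm-enum))
  where Fm-enum = allFin-isUniqueEnumeration m

-- With this order, sign (app σ) and sgn σ are definitionally equal.
module _ {m : ℕ} where
  open Inversions (elems-isUniqueEnumeration m) (λ u v → rank u <ᵇ rank v)
                  (λ u → <ᵇ-irrefl (rank u)) (λ u≢v → <ᵇ-flip (u≢v ∘ rank-injective))
    public using (sign; sign-cong; sign-∘; sign-from*sign-to)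

restrict : (A → Bool) → (A → A) → A → A
restrict X h x = if X x then h x else x

restrict-↔ : (X : A → Bool) (π : A ↔ A) → (∀ x → X (to π x) ≡ X x) → A ↔ A
restrict-↔ X π X-invariant = mk↔ₛ′ (restrict X (to π)) (restrict X (from π)) to∘from from∘to
  where
  X-invariant⁻¹ : ∀ x → X (from π x) ≡ X x
  X-invariant⁻¹ x = trans (sym (X-invariant (from π x))) (cong X (strictlyInverseˡ π x))

  to∘from : ∀ x → restrict X (to π) (restrict X (from π) x) ≡ x
  to∘from x with X x in X-x
  ... | false rewrite X-x = refl
  ... | true  rewrite X-invariant⁻¹ x | X-x = strictlyInverseˡ π x

  from∘to : ∀ x → restrict X (from π) (restrict X (to π) x) ≡ x
  from∘to x with X x in X-x
  ... | false rewrite X-x = refl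
  ... | true  rewrite X-invariant x | X-x = strictlyInverseʳ π x

module KempeSwap {m} {f f' : Fin 3 → Perm m} {r s : Fin 3} {X : V m → Bool}
                 (r≢s : r ≢ s) (X-invariant : UnionOfCycles (τ f r s) X)
                 (f'-swap : IsKempeSwap f r s X f') where

  ρ : Perm m
  ρ = restrict-↔ X (↔-sym (f s) ↔-∘ f r) X-invariant

  f'ˢ≗fˢ∘ρ : ∀ v → app (f' s) v ≡ app (f s) (to ρ v)
  f'ˢ≗fˢ∘ρ v rewrite f'-swap s v | dec-false (s ≟ r) (r≢s ∘ sym) | dec-true (s ≟ s) refl with X v
  ... | true  = sym (strictlyInverseˡ (f s) _)
  ... | false = refl

  f'ʳ≗fʳ∘ρ⁻¹ : ∀ v → app (f' r) v ≡ app (f r) (from ρ v)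
  f'ʳ≗fʳ∘ρ⁻¹ v rewrite f'-swap r v | dec-true (r ≟ r) refl with X v
  ... | true  = sym (strictlyInverseˡ (f r) _)
  ... | false = refl

  f'≗f-elsewhere : ∀ {t} → t ≢ r → t ≢ s → ∀ v → app (f' t) v ≡ app (f t) v
  f'≗f-elsewhere {t} t≢r t≢s v rewrite f'-swap t v | dec-false (t ≟ r) t≢r | dec-false (t ≟ s) t≢s
    with X v
  ... | true  = refl
  ... | false = refl

  sgn-swapped-pair : sgn (f' r) * sgn (f' s) ≡ sgn (f r) * sgn (f s)
  sgn-swapped-pair = begin
    sgn (f' r) * sgn (f' s)
      ≡⟨ cong₂ _*_ (sign-cong f'ʳ≗fʳ∘ρ⁻¹) (sign-cong f'ˢ≗fˢ∘ρ) ⟩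
    sign (app (f r) ∘ from ρ) * sign (app (f s) ∘ to ρ)
      ≡⟨ cong₂ _*_ (sign-∘ (f r) (↔-sym ρ)) (sign-∘ (f s) ρ) ⟩
    (sgn (f r) * sign (from ρ)) * (sgn (f s) * sign (to ρ))
      ≡⟨ ℤ*.interchange (sgn (f r)) (sign (from ρ)) (sgn (f s)) (sign (to ρ)) ⟩
    (sgn (f r) * sgn (f s)) * (sign (from ρ) * sign (to ρ))
      ≡⟨ cong ((sgn (f r) * sgn (f s)) *_) (sign-from*sign-to ρ) ⟩
    (sgn (f r) * sgn (f s)) * 1ℤ
      ≡⟨ *-identityʳ _ ⟩
    sgn (f r) * sgn (f s) ∎

  sgn-elsewhere : ∀ {t} → t ≢ r → t ≢ s → sgn (f' t) ≡ sgn (f t)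
  sgn-elsewhere t≢r t≢s = sign-cong (f'≗f-elsewhere t≢r t≢s)

product₃-reorder : ∀ {r s : Fin 3} → r ≢ s → ∃[ t ] t ≢ r × t ≢ s ×
  (∀ (G : Fin 3 → ℤ) → G f0 * G (fs f0) * G (fs (fs f0)) ≡ G r * G s * G t)
product₃-reorder {f0}         {f0}         r≢s = contradiction refl r≢s
product₃-reorder {f0}         {fs f0}      _   = fs (fs f0) , (λ ()) , (λ ()) , λ G → refl
product₃-reorder {f0}         {fs (fs f0)} _   =
  fs f0 , (λ ()) , (λ ()) , λ G → ℤ*.xy∙z≈xz∙y (G f0) (G (fs f0)) (G (fs (fs f0)))
product₃-reorder {fs f0}      {f0}         _   =
  fs (fs f0) , (λ ()) , (λ ()) , λ G → ℤ*.xy∙z≈yx∙z (G f0) (G (fs f0)) (G (fs (fs f0)))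
product₃-reorder {fs f0}      {fs f0}      r≢s = contradiction refl r≢s
product₃-reorder {fs f0}      {fs (fs f0)} _   =
  f0 , (λ ()) , (λ ()) , λ G → ℤ*.xy∙z≈yz∙x (G f0) (G (fs f0)) (G (fs (fs f0)))
product₃-reorder {fs (fs f0)} {f0}         _   =
  fs f0 , (λ ()) , (λ ()) , λ G → ℤ*.xy∙z≈zx∙y (G f0) (G (fs f0)) (G (fs (fs f0)))
product₃-reorder {fs (fs f0)} {fs f0}      _   =
  f0 , (λ ()) , (λ ()) , λ G → ℤ*.xy∙z≈zy∙x (G f0) (G (fs f0)) (G (fs (fs f0)))
product₃-reorder {fs (fs f0)} {fs (fs f0)} r≢s = contradiction refl r≢s

theorem2p5 : (m : ℕ) → 3 ≤ m →
    (f : Fin 3 → Perm m) → IsColoring f →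
    (r s : Fin 3) → r ≢ s →
    (X : V m → Bool) → UnionOfCycles (τ f r s) X →
    (f' : Fin 3 → Perm m) → IsKempeSwap f r s X f' →
    sgn (f' f0) * sgn (f' (fs f0)) * sgn (f' (fs (fs f0)))
      ≡ sgn (f f0) * sgn (f (fs f0)) * sgn (f (fs (fs f0)))
theorem2p5 m _ f _ r s r≢s X X-invariant f' f'-swap
  with t , t≢r , t≢s , reorder ← product₃-reorder r≢s = begin
    sgn (f' f0) * sgn (f' (fs f0)) * sgn (f' (fs (fs f0))) ≡⟨ reorder (sgn ∘ f') ⟩
    sgn (f' r) * sgn (f' s) * sgn (f' t)                   ≡⟨ cong₂ _*_ sgn-swapped-pair (sgn-elsewhere t≢r t≢s) ⟩
    sgn (f r) * sgn (f s) * sgn (f t)                      ≡⟨ reorder (sgn ∘ f) ⟨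
    sgn (f f0) * sgn (f (fs f0)) * sgn (f (fs (fs f0)))    ∎
  where open KempeSwap {f = f} {f' = f'} r≢s X-invariant f'-swap
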